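{- Let $p > 3$ be a prime and assume that $|\mathcal{L}_{\lambda}(p)| = p-1$. Then $$S_{\lambda}(3\xi) = S_{\lambda}(2\xi) = -S_{\lambda}(\xi) \quad \text{for all } \xi \in \mathbb{Z}/p\mathbb{Z}.$$ In particular, for all integers $j,k \geq 0$, $$S_{\lambda}(3^j) = (-1)^j S_{\lambda}(1), \qquad S_{\lambda}(2^k) = (-1)^k S_{\lambda}(1).$$
   Context: $\lambda$ is the Liouville function, $\lambda(n)=(-1)^{\Omega(n)}$ with $\Omega(n)$ the number of prime factors of $n$ counted with multiplicity. For an integer $N \geq 1$, $\mathcal{L}_{\lambda}(N) := \sum_{1 \leq n < N} \lambda(n)\lambda(N-n)$. For a prime $p$ and $\xi \in \mathbb{Z}/p\mathbb{Z}$, $S_{\lambda}(\xi) := \sum_{1 \leq n < p} \lambda(n) e(n\xi/p)$, where $e(t) = e^{2\pi i t}$. -}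

module Defs where

open import Data.Nat using (ℕ; zero; suc; NonZero)
open import Data.Nat.DivMod using (_%_)
open import Data.Nat.Primality.Factorisation using (factorise; factors)
open import Data.List using (length)
open import Data.Integer using (ℤ; -1ℤ; 0ℤ; _^_) renaming (_+_ to _+ℤ_; _*_ to _*ℤ_; -_ to -ℤ_)
open import Data.Fin using (Fin; toℕ)
open import Data.Product using (∃)
open import Relation.Binary.PropositionalEquality using (_≡_)
open import Relation.Nullary using (does)
open import Data.Bool using (if_then_else_)
import Data.Nat as ℕ

Ω : (n : ℕ) → .{{NonZero n}} → ℕ
Ω n = length (factors (factorise n))

-- Liouville function λ(n) = (-1)^Ω(n) for n ≥ 1 (value at 0 is irrelevant; set to 0).
liouville : ℕ → ℤ
liouville zero    = 0ℤ
liouville (suc n) = -1ℤ ^ Ω (suc n)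

sumBelow : ℕ → (ℕ → ℤ) → ℤ
sumBelow zero    f = 0ℤ
sumBelow (suc n) f = sumBelow n f +ℤ f n

sumFrom1Below : ℕ → (ℕ → ℤ) → ℤ
sumFrom1Below N f = sumBelow (N ℕ.∸ 1) (λ i → f (suc i))

Lλ : ℕ → ℤ
Lλ N = sumFrom1Below N (λ n → liouville n *ℤ liouville (N ℕ.∸ n))

-- Elements Σ_r c_r ζ^r of ℤ[ζ_p] (ζ = e(1/p)), represented by their
-- coefficient vectors c : Fin p → ℤ.
Cyc : ℕ → Set
Cyc p = Fin p → ℤ

-- Equality in ℤ[ζ_p] ⊂ ℂ: Σ a_r ζ^r = Σ b_r ζ^r holds iff a - b is a
-- constant vector (the only ℤ-linear relation is 1 + ζ + … + ζ^{p-1} = 0).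
_≈ζ_ : {p : ℕ} → Cyc p → Cyc p → Set
_≈ζ_ a b = ∃ λ (c : ℤ) → ∀ r → a r ≡ b r +ℤ c

negζ : {p : ℕ} → Cyc p → Cyc p
negζ a r = -ℤ (a r)

-- S_λ(ξ) = Σ_{1 ≤ n < p} λ(n) e(nξ/p) = Σ_r (Σ_{1≤n<p, nξ ≡ r (mod p)} λ(n)) ζ^r.
-- ξ is given as a natural number (its residue mod p is what matters).
Sλ : (p : ℕ) → .{{NonZero p}} → ℕ → Cyc p
Sλ p ξ r = sumFrom1Below p (λ n →
  if does ((n ℕ.* ξ) % p ℕ.≟ toℕ r) then liouville n else 0ℤ)

signζ : {p : ℕ} → ℕ → Cyc p → Cyc p
signζ zero    a = a
signζ (suc j) a = negζ (signζ j a)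

{-# OPTIONS --safe #-}
-- Each term λ(n) λ(p − n) of 𝓛_λ(p) is ±1, so |𝓛_λ(p)| = p − 1 forces all of them to be
-- one sign c: λ(p − n) = c λ(n) for 0 < n < p. Together with λ(k m) = −λ(m) for primes k
-- this gives λ(k n mod p) = −λ(n) for k = 2, 3: when k n = x + (k − 1) p we have
-- x = p − k (p − n), and the remaining case 3n = x + p reduces to these through 2n mod p.
-- Multiplication by k permutes the nonzero residues mod p, so reindexing the sum defining
-- S_λ(k ξ) gives S_λ(k ξ) = −S_λ(ξ); iterating gives the statements for powers of 2 and 3.
module Submission where

open import Defs
open import Data.Nat using (ℕ; _>_; _∸_; _^_; _*_; NonZero)
open import Data.Nat.Primality using (Prime)
open import Data.Integer using (∣_∣)
open import Data.Fin using (Fin; toℕ)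
open import Data.Product using (_×_)
open import Relation.Binary.PropositionalEquality using (_≡_)

open import Data.Nat using (zero; suc; _+_; _<_; z≤n; s≤s; _≟_; >-nonZero; nonTrivial⇒n>1)
open import Data.Nat.Properties
  using (m<n⇒m<1+n; n<1+n; ≤-pred; ≤∧≢⇒<; m<1+n⇒m<n∨m≡n; suc-injective; n≢0⇒n>0; <⇒≢; <⇒≱;
         m<n⇒0<n∸m; m+[n∸m]≡n; m+n∸m≡n; m<m+n; m≤m+n; <⇒≤; ≤-trans; +-identityʳ; +-cancelʳ-≡; +-comm; +-assoc;
         *-comm; *-assoc; *-identityˡ; *-zeroʳ; *-distribˡ-+; *-monoʳ-<; m*n≢0)
open import Data.Nat.DivMod
  using (_%_; _/_; m≡m%n+[m/n]*n; m%n<n; m%n%n≡m%n; %-distribˡ-*; [m+kn]%n≡m%n; m<n⇒m%n≡m;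
         m*n%n≡0; m<n*o⇒m/o<n)
open import Data.Nat.Divisibility using (_∣_; ∣⇒≤; m%n≡0⇒n∣m)
open import Data.Nat.Coprimality using (coprime-Bézout; prime⇒coprime)
open import Data.Nat.GCD using (module Bézout)
open import Data.Nat.Primality using (prime?; prime[2]; prime⇒nonZero; prime⇒nonTrivial; euclidsLemma)
open import Data.Nat.Primality.Factorisation using (PrimeFactorisation; factorise; factors; factorisationUnique)
open import Data.List using (_∷_)
open import Data.List.Relation.Unary.All using (_∷_)
open import Data.List.Relation.Binary.Permutation.Propositional.Properties using (↭-length)
open import Data.Integer using (ℤ; +_; -[1+_]; -≤+; 0ℤ; 1ℤ; -1ℤ)
  renaming (_+_ to _+ℤ_; _*_ to _*ℤ_; -_ to -ℤ_; _^_ to _^ℤ_; _≤_ to _≤ℤ_)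
import Data.Integer.Properties as ℤ
import Data.Integer.Tactic.RingSolver as ℤ-Solver
import Data.Nat.Tactic.RingSolver as ℕ-Solver
open import Data.Bool using (if_then_else_; true; false)
open import Data.Product using (∃; _,_; proj₁; proj₂)
open import Data.Sum using (_⊎_; inj₁; inj₂; [_,_]′)
open import Function using (_∘_)
open import Relation.Binary.PropositionalEquality using (_≢_; _≗_; refl; sym; trans; cong; cong₂; subst; module ≡-Reasoning)
open import Relation.Nullary using (does; yes; no; ¬_)
open import Relation.Nullary.Decidable using (from-yes; dec-true; dec-false)

open ≡-Reasoning

IsSign : ℤ → Set
IsSign x = x ≡ 1ℤ ⊎ x ≡ -1ℤ

-1^-isSign : ∀ k → IsSign (-1ℤ ^ℤ k)
-1^-isSign zero = inj₁ refl
-1^-isSign (suc k) with -1^-isSign k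
... | inj₁ e = inj₂ (cong (-1ℤ *ℤ_) e)
... | inj₂ e = inj₁ (cong (-1ℤ *ℤ_) e)

isSign-* : ∀ {x y} → IsSign x → IsSign y → IsSign (x *ℤ y)
isSign-* (inj₁ refl) (inj₁ refl) = inj₁ refl
isSign-* (inj₁ refl) (inj₂ refl) = inj₂ refl
isSign-* (inj₂ refl) (inj₁ refl) = inj₂ refl
isSign-* (inj₂ refl) (inj₂ refl) = inj₁ refl

isSign-neg : ∀ {x} → IsSign x → IsSign (-ℤ x)
isSign-neg (inj₁ refl) = inj₂ refl
isSign-neg (inj₂ refl) = inj₁ refl

isSign⇒≤1 : ∀ {x} → IsSign x → x ≤ℤ 1ℤ
isSign⇒≤1 (inj₁ refl) = ℤ.≤-refl
isSign⇒≤1 (inj₂ refl) = -≤+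

isSign-square : ∀ {x} → IsSign x → x *ℤ x ≡ 1ℤ
isSign-square (inj₁ refl) = refl
isSign-square (inj₂ refl) = refl

liouville≡-1^Ω : ∀ n .{{_ : NonZero n}} → liouville n ≡ -1ℤ ^ℤ Ω n
liouville≡-1^Ω (suc n) = refl

liouville-isSign : ∀ {n} → 0 < n → IsSign (liouville n)
liouville-isSign {suc n} _ = -1^-isSign (Ω (suc n))

Ω-*-prime : ∀ {k} n → Prime k → .{{_ : NonZero k}} .{{_ : NonZero n}} →
            Ω (k * n) {{m*n≢0 k n}} ≡ suc (Ω n)
Ω-*-prime {k} n k-prime = ↭-length (factorisationUnique (factorise (k * n) {{m*n≢0 k n}}) k∷factors)
  where
  k∷factors : PrimeFactorisation (k * n)
  k∷factors = record
    { factors         = k ∷ factors (factorise n)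
    ; isFactorisation = cong (k *_) (PrimeFactorisation.isFactorisation (factorise n))
    ; factorsPrime    = k-prime ∷ PrimeFactorisation.factorsPrime (factorise n)
    }

liouville-*-prime : ∀ {k n} → Prime k → 0 < n → liouville (k * n) ≡ -ℤ liouville n
liouville-*-prime {k} {n} k-prime 0<n = begin
  liouville (k * n)        ≡⟨ liouville≡-1^Ω (k * n) ⟩
  -1ℤ ^ℤ Ω (k * n)         ≡⟨ cong (-1ℤ ^ℤ_) (Ω-*-prime n k-prime) ⟩
  -1ℤ *ℤ (-1ℤ ^ℤ Ω n)      ≡⟨ ℤ.-1*i≡-i _ ⟩
  -ℤ (-1ℤ ^ℤ Ω n)          ≡⟨ cong -ℤ_ (liouville≡-1^Ω n) ⟨
  -ℤ liouville n           ∎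
  where
  instance
    k≢0  = prime⇒nonZero k-prime
    n≢0  = >-nonZero 0<n
    kn≢0 = m*n≢0 k n

sumBelow-cong : ∀ N {f g : ℕ → ℤ} → (∀ {i} → i < N → f i ≡ g i) → sumBelow N f ≡ sumBelow N g
sumBelow-cong zero    _   = refl
sumBelow-cong (suc N) f≡g = cong₂ _+ℤ_ (sumBelow-cong N (f≡g ∘ m<n⇒m<1+n)) (f≡g (n<1+n N))

sumBelow-zero : ∀ N {f : ℕ → ℤ} → (∀ {i} → i < N → f i ≡ 0ℤ) → sumBelow N f ≡ 0ℤ
sumBelow-zero zero    _   = refl
sumBelow-zero (suc N) f≡0 = cong₂ _+ℤ_ (sumBelow-zero N (f≡0 ∘ m<n⇒m<1+n)) (f≡0 (n<1+n N))

sumBelow-neg : ∀ N (f : ℕ → ℤ) → sumBelow N (-ℤ_ ∘ f) ≡ -ℤ sumBelow N f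
sumBelow-neg zero    f = refl
sumBelow-neg (suc N) f = begin
  sumBelow N (-ℤ_ ∘ f) +ℤ -ℤ f N    ≡⟨ cong (_+ℤ -ℤ f N) (sumBelow-neg N f) ⟩
  -ℤ sumBelow N f +ℤ -ℤ f N         ≡⟨ ℤ.neg-distrib-+ (sumBelow N f) (f N) ⟨
  -ℤ (sumBelow N f +ℤ f N)          ∎

sumBelow-+ : ∀ N (f g : ℕ → ℤ) → sumBelow N (λ i → f i +ℤ g i) ≡ sumBelow N f +ℤ sumBelow N g
sumBelow-+ zero    f g = refl
sumBelow-+ (suc N) f g = begin
  sumBelow N (λ i → f i +ℤ g i) +ℤ (f N +ℤ g N)         ≡⟨ cong (_+ℤ (f N +ℤ g N)) (sumBelow-+ N f g) ⟩
  (sumBelow N f +ℤ sumBelow N g) +ℤ (f N +ℤ g N)        ≡⟨ interchange (sumBelow N f) (sumBelow N g) (f N) (g N) ⟩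
  (sumBelow N f +ℤ f N) +ℤ (sumBelow N g +ℤ g N)        ∎
  where
  interchange : ∀ a b c d → (a +ℤ b) +ℤ (c +ℤ d) ≡ (a +ℤ c) +ℤ (b +ℤ d)
  interchange = ℤ-Solver.solve-∀

sumBelow-swap : ∀ N M (f : ℕ → ℕ → ℤ) →
                sumBelow N (λ i → sumBelow M (f i)) ≡ sumBelow M (λ j → sumBelow N (λ i → f i j))
sumBelow-swap zero    M f = sym (sumBelow-zero M (λ _ → refl))
sumBelow-swap (suc N) M f = begin
  sumBelow N (λ i → sumBelow M (f i)) +ℤ sumBelow M (f N)
    ≡⟨ cong (_+ℤ sumBelow M (f N)) (sumBelow-swap N M f) ⟩
  sumBelow M (λ j → sumBelow N (λ i → f i j)) +ℤ sumBelow M (f N)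
    ≡⟨ sumBelow-+ M (λ j → sumBelow N (λ i → f i j)) (f N) ⟨
  sumBelow M (λ j → sumBelow N (λ i → f i j) +ℤ f N j)
    ∎

sumBelow-single : ∀ N {a} {f : ℕ → ℤ} → a < N → (∀ {i} → i < N → i ≢ a → f i ≡ 0ℤ) →
                  sumBelow N f ≡ f a
sumBelow-single (suc N) {a} {f} a<1+N f≡0 with a ≟ N
... | yes refl = begin
  sumBelow N f +ℤ f a   ≡⟨ cong (_+ℤ f a) (sumBelow-zero N (λ i<N → f≡0 (m<n⇒m<1+n i<N) (<⇒≢ i<N))) ⟩
  0ℤ +ℤ f a             ≡⟨ ℤ.+-identityˡ (f a) ⟩
  f a                   ∎
... | no a≢N = begin
  sumBelow N f +ℤ f N   ≡⟨ cong₂ _+ℤ_ (sumBelow-single N a<N (f≡0 ∘ m<n⇒m<1+n)) (f≡0 (n<1+n N) (a≢N ∘ sym)) ⟩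
  f a +ℤ 0ℤ             ≡⟨ ℤ.+-identityʳ (f a) ⟩
  f a                   ∎
  where a<N = ≤∧≢⇒< (≤-pred a<1+N) a≢N

+-≤-tight : ∀ {x y m n} → x ≤ℤ m → y ≤ℤ n → x +ℤ y ≡ m +ℤ n → x ≡ m × y ≡ n
+-≤-tight x≤m y≤n x+y≡m+n =
    ℤ.≤∧≮⇒≡ x≤m (λ x<m → ℤ.<-irrefl x+y≡m+n (ℤ.+-mono-<-≤ x<m y≤n))
  , ℤ.≤∧≮⇒≡ y≤n (λ y<n → ℤ.<-irrefl x+y≡m+n (ℤ.+-mono-≤-< x≤m y<n))

sumBelow-≤ : ∀ N {t : ℕ → ℤ} → (∀ {i} → i < N → t i ≤ℤ 1ℤ) → sumBelow N t ≤ℤ + N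
sumBelow-≤ zero    _   = ℤ.≤-refl
sumBelow-≤ (suc N) {t} t≤1 = subst (sumBelow N t +ℤ t N ≤ℤ_) (ℤ.+-comm (+ N) 1ℤ)
  (ℤ.+-mono-≤ (sumBelow-≤ N (t≤1 ∘ m<n⇒m<1+n)) (t≤1 (n<1+n N)))

sumBelow≡N⇒≡1 : ∀ N {t : ℕ → ℤ} → (∀ {i} → i < N → t i ≤ℤ 1ℤ) → sumBelow N t ≡ + N →
                ∀ {i} → i < N → t i ≡ 1ℤ
sumBelow≡N⇒≡1 (suc N) {t} t≤1 sum≡1+N i<1+N
  with sum≡N , tN≡1 ← +-≤-tight (sumBelow-≤ N (t≤1 ∘ m<n⇒m<1+n)) (t≤1 (n<1+n N))
                                (trans sum≡1+N (ℤ.+-comm 1ℤ (+ N)))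
     | m<1+n⇒m<n∨m≡n i<1+N
... | inj₁ i<N  = sumBelow≡N⇒≡1 N (t≤1 ∘ m<n⇒m<1+n) sum≡N i<N
... | inj₂ refl = tN≡1

∣i∣≡n⇒i≡±n : ∀ {i n} → ∣ i ∣ ≡ n → i ≡ + n ⊎ i ≡ -ℤ + n
∣i∣≡n⇒i≡±n {+ _}       refl = inj₁ refl
∣i∣≡n⇒i≡±n { -[1+ _ ]} refl = inj₂ refl

∣sumBelow∣≡N⇒constant : ∀ N {t : ℕ → ℤ} → (∀ {i} → i < N → IsSign (t i)) → ∣ sumBelow N t ∣ ≡ N →
                        ∃ λ c → ∀ {i} → i < N → t i ≡ c
∣sumBelow∣≡N⇒constant N {t} t-sign ∣sum∣≡N with ∣i∣≡n⇒i≡±n ∣sum∣≡N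
... | inj₁ sum≡N  = 1ℤ , sumBelow≡N⇒≡1 N (isSign⇒≤1 ∘ t-sign) sum≡N
... | inj₂ sum≡-N = -1ℤ , λ i<N → ℤ.neg-injective (sumBelow≡N⇒≡1 N (isSign⇒≤1 ∘ isSign-neg ∘ t-sign) -sum≡N i<N)
  where
  -sum≡N : sumBelow N (-ℤ_ ∘ t) ≡ + N
  -sum≡N = trans (sumBelow-neg N t) (trans (cong -ℤ_ sum≡-N) (ℤ.neg-involutive (+ N)))

sumFrom1Below-cong : ∀ p {f g : ℕ → ℤ} → (∀ {n} → 0 < n → n < p → f n ≡ g n) →
                     sumFrom1Below p f ≡ sumFrom1Below p g
sumFrom1Below-cong zero    _   = refl
sumFrom1Below-cong (suc N) f≡g = sumBelow-cong N (λ i<N → f≡g (s≤s z≤n) (s≤s i<N))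

sumFrom1Below-single : ∀ p {a} {f : ℕ → ℤ} → 0 < a → a < p →
                       (∀ {n} → 0 < n → n < p → n ≢ a → f n ≡ 0ℤ) → sumFrom1Below p f ≡ f a
sumFrom1Below-single (suc N) {suc a} _ (s≤s a<N) f≡0 =
  sumBelow-single N a<N (λ i<N i≢a → f≡0 (s≤s z≤n) (s≤s i<N) (i≢a ∘ suc-injective))

δ : ℕ → ℕ → ℤ → ℤ
δ x y v = if does (x ≟ y) then v else 0ℤ

δ-≡ : ∀ {x y v} → x ≡ y → δ x y v ≡ v
δ-≡ {x} {y} x≡y rewrite dec-true (x ≟ y) x≡y = refl

δ-≢ : ∀ {x y v} → x ≢ y → δ x y v ≡ 0ℤ
δ-≢ {x} {y} x≢y rewrite dec-false (x ≟ y) x≢y = refl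

δ-neg : ∀ x y v → δ x y (-ℤ v) ≡ -ℤ δ x y v
δ-neg x y v with does (x ≟ y)
... | true  = refl
... | false = refl

record InverseOn (p : ℕ) (σ τ : ℕ → ℕ) : Set where
  field
    σ-range : ∀ {n} → 0 < n → n < p → 0 < σ n × σ n < p
    τ-range : ∀ {n} → 0 < n → n < p → 0 < τ n × τ n < p
    τ∘σ≡id  : ∀ {n} → 0 < n → n < p → τ (σ n) ≡ n
    σ∘τ≡id  : ∀ {n} → 0 < n → n < p → σ (τ n) ≡ n

-- Insert Σ_m [σ n = m] and swap the sums; τ m is the only n with σ n = m.
sumFrom1Below-reindex : ∀ p {σ τ} (f : ℕ → ℤ) → InverseOn p σ τ →
                        sumFrom1Below p (f ∘ σ) ≡ sumFrom1Below p f
sumFrom1Below-reindex p {σ} {τ} f inv = begin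
  sumFrom1Below p (f ∘ σ)
    ≡⟨ sumFrom1Below-cong p (λ 0<n n<p → sym (pick-σ 0<n n<p)) ⟩
  sumFrom1Below p (λ n → sumFrom1Below p (λ m → δ (σ n) m (f m)))
    ≡⟨ sumBelow-swap (p ∸ 1) (p ∸ 1) (λ i j → δ (σ (suc i)) (suc j) (f (suc j))) ⟩
  sumFrom1Below p (λ m → sumFrom1Below p (λ n → δ (σ n) m (f m)))
    ≡⟨ sumFrom1Below-cong p pick-τ ⟩
  sumFrom1Below p f
    ∎
  where
  open InverseOn inv
  pick-σ : ∀ {n} → 0 < n → n < p → sumFrom1Below p (λ m → δ (σ n) m (f m)) ≡ f (σ n)
  pick-σ {n} 0<n n<p = trans
    (sumFrom1Below-single p {f = λ m → δ (σ n) m (f m)} (proj₁ (σ-range 0<n n<p)) (proj₂ (σ-range 0<n n<p))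
      (λ _ _ m≢σn → δ-≢ (m≢σn ∘ sym)))
    (δ-≡ {σ n} refl)
  pick-τ : ∀ {m} → 0 < m → m < p → sumFrom1Below p (λ n → δ (σ n) m (f m)) ≡ f m
  pick-τ {m} 0<m m<p = trans
    (sumFrom1Below-single p {f = λ n → δ (σ n) m (f m)} (proj₁ (τ-range 0<m m<p)) (proj₂ (τ-range 0<m m<p))
      (λ 0<n n<p n≢τm → δ-≢ (λ σn≡m → n≢τm (trans (sym (τ∘σ≡id 0<n n<p)) (cong τ σn≡m)))))
    (δ-≡ (σ∘τ≡id 0<m m<p))

[m*[n%d]]%d≡[m*n]%d : ∀ m n d .{{_ : NonZero d}} → (m * (n % d)) % d ≡ (m * n) % d
[m*[n%d]]%d≡[m*n]%d m n d = begin
  (m * (n % d)) % d              ≡⟨ %-distribˡ-* m (n % d) d ⟩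
  ((m % d) * (n % d % d)) % d    ≡⟨ cong (λ k → ((m % d) * k) % d) (m%n%n≡m%n n d) ⟩
  ((m % d) * (n % d)) % d        ≡⟨ %-distribˡ-* m n d ⟨
  (m * n) % d                    ∎

module _ {p : ℕ} .{{_ : NonZero p}} where

  1%p≡1 : Prime p → 1 % p ≡ 1
  1%p≡1 p-prime = m<n⇒m%n≡m (nonTrivial⇒n>1 p {{prime⇒nonTrivial p-prime}})

  mod-inverse : ∀ {a} → Prime p → 0 < a → a < p → ∃ λ b → (b * a) % p ≡ 1
  mod-inverse {a} p-prime 0<a a<p with coprime-Bézout (prime⇒coprime p-prime {{>-nonZero 0<a}} a<p)
  ... | Bézout.-+ x y 1+xp≡ya = y , (begin
    (y * a) % p        ≡⟨ cong (_% p) 1+xp≡ya ⟨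
    (1 + x * p) % p    ≡⟨ [m+kn]%n≡m%n 1 x p ⟩
    1 % p              ≡⟨ 1%p≡1 p-prime ⟩
    1                  ∎)
  -- y * a ≡ -1 (mod p), so its square is 1
  ... | Bézout.+- x y 1+ya≡xp = y * u , (begin
    (y * u * a) % p         ≡⟨ cong (_% p) (y*[y*a]*a≡[y*a]*[y*a] y a) ⟩
    (u * u) % p             ≡⟨ [m+kn]%n≡m%n (u * u) x p ⟨
    (u * u + x * p) % p     ≡⟨ cong (λ k → (u * u + k) % p) 1+ya≡xp ⟨
    (u * u + (1 + u)) % p   ≡⟨ cong (_% p) (u*u+[1+u]≡1+u*[1+u] u) ⟩
    (1 + u * (1 + u)) % p   ≡⟨ cong (λ k → (1 + u * k) % p) 1+ya≡xp ⟩
    (1 + u * (x * p)) % p   ≡⟨ cong (λ k → (1 + k) % p) (*-assoc u x p) ⟨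
    (1 + u * x * p) % p     ≡⟨ [m+kn]%n≡m%n 1 (u * x) p ⟩
    1 % p                   ≡⟨ 1%p≡1 p-prime ⟩
    1                       ∎)
    where
    u = y * a
    u*u+[1+u]≡1+u*[1+u] : ∀ u → u * u + (1 + u) ≡ 1 + u * (1 + u)
    u*u+[1+u]≡1+u*[1+u] = ℕ-Solver.solve-∀
    y*[y*a]*a≡[y*a]*[y*a] : ∀ y a → y * (y * a) * a ≡ y * a * (y * a)
    y*[y*a]*a≡[y*a]*[y*a] = ℕ-Solver.solve-∀

  [a*n]%p>0 : ∀ {a n} → Prime p → 0 < a → a < p → 0 < n → n < p → 0 < (a * n) % p
  [a*n]%p>0 {a} {n} p-prime 0<a a<p 0<n n<p = n≢0⇒n>0 (λ an%p≡0 →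
    [ p∤ 0<a a<p , p∤ 0<n n<p ]′ (euclidsLemma a n p-prime (m%n≡0⇒n∣m (a * n) p an%p≡0)))
    where
    p∤ : ∀ {m} → 0 < m → m < p → ¬ p ∣ m
    p∤ 0<m m<p p∣m = <⇒≱ m<p (∣⇒≤ {{>-nonZero 0<m}} p∣m)

  [b*[a*n%p]]%p≡n : ∀ {a b n} → (b * a) % p ≡ 1 → n < p → (b * ((a * n) % p)) % p ≡ n
  [b*[a*n%p]]%p≡n {a} {b} {n} ba≡1 n<p = begin
    (b * ((a * n) % p)) % p          ≡⟨ [m*[n%d]]%d≡[m*n]%d b (a * n) p ⟩
    (b * (a * n)) % p                ≡⟨ cong (_% p) (*-assoc b a n) ⟨
    (b * a * n) % p                  ≡⟨ %-distribˡ-* (b * a) n p ⟩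
    ((b * a) % p * (n % p)) % p      ≡⟨ cong (λ k → (k * (n % p)) % p) ba≡1 ⟩
    (1 * (n % p)) % p                ≡⟨ cong (_% p) (*-identityˡ (n % p)) ⟩
    n % p % p                        ≡⟨ m%n%n≡m%n n p ⟩
    n % p                            ≡⟨ m<n⇒m%n≡m n<p ⟩
    n                                ∎

  *-%-inverseOn : ∀ {a b} → (b * a) % p ≡ 1 → InverseOn p (λ n → (a * n) % p) (λ n → (b * n) % p)
  *-%-inverseOn {a} {b} ba≡1 = record
    { σ-range = range {a} {b} ba≡1
    ; τ-range = range {b} {a} ab≡1
    ; τ∘σ≡id  = λ _ → [b*[a*n%p]]%p≡n {a} {b} ba≡1
    ; σ∘τ≡id  = λ _ → [b*[a*n%p]]%p≡n {b} {a} ab≡1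
    }
    where
    ab≡1 : (a * b) % p ≡ 1
    ab≡1 = trans (cong (_% p) (*-comm a b)) ba≡1
    range : ∀ {a b n} → (b * a) % p ≡ 1 → 0 < n → n < p → 0 < (a * n) % p × (a * n) % p < p
    range {a} {b} {n} ba≡1 0<n n<p = n≢0⇒n>0 an%p≢0 , m%n<n (a * n) p
      where
      an%p≢0 : (a * n) % p ≢ 0
      an%p≢0 an%p≡0 = <⇒≢ 0<n (begin
        0                        ≡⟨ m*n%n≡0 0 p ⟨
        0 % p                    ≡⟨ cong (_% p) (*-zeroʳ b) ⟨
        (b * 0) % p              ≡⟨ cong (λ k → (b * k) % p) an%p≡0 ⟨
        (b * ((a * n) % p)) % p  ≡⟨ [b*[a*n%p]]%p≡n {a} {b} ba≡1 n<p ⟩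
        n                        ∎)

  Sλ-*-negate : ∀ a → (∃ λ b → (b * a) % p ≡ 1) →
                (∀ {n} → 0 < n → n < p → liouville ((a * n) % p) ≡ -ℤ liouville n) →
                ∀ ξ → Sλ p (a * ξ) ≗ negζ (Sλ p ξ)
  Sλ-*-negate a (b , ba≡1) flip ξ r = begin
    Sλ p (a * ξ) r                       ≡⟨ sumFrom1Below-cong p term ⟩
    sumFrom1Below p (λ n → -ℤ G (σ n))   ≡⟨ sumBelow-neg (p ∸ 1) (G ∘ σ ∘ suc) ⟩
    -ℤ sumFrom1Below p (G ∘ σ)           ≡⟨ cong -ℤ_ (sumFrom1Below-reindex p G (*-%-inverseOn {a = a} {b = b} ba≡1)) ⟩
    -ℤ Sλ p ξ r                          ∎
    where
    σ : ℕ → ℕ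
    σ n = (a * n) % p
    G : ℕ → ℤ
    G m = δ ((m * ξ) % p) (toℕ r) (liouville m)
    index : ∀ n → (n * (a * ξ)) % p ≡ (σ n * ξ) % p
    index n = begin
      (n * (a * ξ)) % p   ≡⟨ cong (_% p) (rearrange n a ξ) ⟩
      (ξ * (a * n)) % p   ≡⟨ [m*[n%d]]%d≡[m*n]%d ξ (a * n) p ⟨
      (ξ * σ n) % p       ≡⟨ cong (_% p) (*-comm ξ (σ n)) ⟩
      (σ n * ξ) % p       ∎
      where
      rearrange : ∀ n a ξ → n * (a * ξ) ≡ ξ * (a * n)
      rearrange = ℕ-Solver.solve-∀
    term : ∀ {n} → 0 < n → n < p → δ ((n * (a * ξ)) % p) (toℕ r) (liouville n) ≡ -ℤ G (σ n)
    term {n} 0<n n<p = begin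
      δ ((n * (a * ξ)) % p) (toℕ r) (liouville n)      ≡⟨ cong₂ (λ x v → δ x (toℕ r) v) (index n) λn≡-λσn ⟩
      δ ((σ n * ξ) % p) (toℕ r) (-ℤ liouville (σ n))   ≡⟨ δ-neg ((σ n * ξ) % p) (toℕ r) (liouville (σ n)) ⟩
      -ℤ G (σ n)                                       ∎
      where
      λn≡-λσn : liouville n ≡ -ℤ liouville (σ n)
      λn≡-λσn = trans (sym (ℤ.neg-involutive (liouville n))) (cong -ℤ_ (sym (flip 0<n n<p)))

  Sλ-^-signζ : ∀ {a} → (∀ ξ → Sλ p (a * ξ) ≗ negζ (Sλ p ξ)) → ∀ j → Sλ p (a ^ j) ≗ signζ j (Sλ p 1)
  Sλ-^-signζ S-negate zero    r = refl
  Sλ-^-signζ {a} S-negate (suc j) r = trans (S-negate (a ^ j) r) (cong -ℤ_ (Sλ-^-signζ S-negate j r))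

LiouvilleReflection : ℕ → ℤ → Set
LiouvilleReflection p c = ∀ {m n} → 0 < m → 0 < n → m + n ≡ p → liouville n ≡ c *ℤ liouville m

∣Lλ∣≡p∸1⇒reflection : ∀ p → ∣ Lλ p ∣ ≡ p ∸ 1 → ∃ (LiouvilleReflection p)
∣Lλ∣≡p∸1⇒reflection zero    _   = 0ℤ , λ { {suc _} _ _ () }
∣Lλ∣≡p∸1⇒reflection (suc N) hyp = c , reflect
  where
  term-sign : ∀ {i} → i < N → IsSign (liouville (suc i) *ℤ liouville (N ∸ i))
  term-sign {i} i<N = isSign-* (liouville-isSign {suc i} (s≤s z≤n)) (liouville-isSign (m<n⇒0<n∸m i<N))

  c : ℤ
  c = proj₁ (∣sumBelow∣≡N⇒constant N term-sign hyp)

  term≡c : ∀ {i} → i < N → liouville (suc i) *ℤ liouville (N ∸ i) ≡ c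
  term≡c = proj₂ (∣sumBelow∣≡N⇒constant N term-sign hyp)

  reflect : LiouvilleReflection (suc N) c
  reflect {suc i} {n} 0<m 0<n 1+i+n≡1+N = begin
    liouville n                                          ≡⟨ ℤ.*-identityˡ (liouville n) ⟨
    1ℤ *ℤ liouville n                                    ≡⟨ cong (_*ℤ liouville n) (isSign-square (liouville-isSign 0<m)) ⟨
    liouville m *ℤ liouville m *ℤ liouville n            ≡⟨ ℤ.*-assoc (liouville m) (liouville m) (liouville n) ⟩
    liouville m *ℤ (liouville m *ℤ liouville n)          ≡⟨ cong (λ k → liouville m *ℤ (liouville m *ℤ liouville k)) N∸i≡n ⟨
    liouville m *ℤ (liouville m *ℤ liouville (N ∸ i))    ≡⟨ cong (liouville m *ℤ_) (term≡c i<N) ⟩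
    liouville m *ℤ c                                     ≡⟨ ℤ.*-comm (liouville m) c ⟩
    c *ℤ liouville m                                     ∎
    where
    m = suc i
    i+n≡N : i + n ≡ N
    i+n≡N = suc-injective 1+i+n≡1+N
    i<N : i < N
    i<N = subst (i <_) i+n≡N (m<m+n i 0<n)
    N∸i≡n : N ∸ i ≡ n
    N∸i≡n = trans (cong (_∸ i) (sym i+n≡N)) (m+n∸m≡n i n)

prime[3] : Prime 3
prime[3] = from-yes (prime? 3)

3n≡x+p⇒6n≡2x+2p : ∀ {n x p} → 3 * n ≡ x + 1 * p → 3 * (2 * n) ≡ 2 * x + 2 * p
3n≡x+p⇒6n≡2x+2p {n} {x} {p} 3n≡x+p = begin
  3 * (2 * n)       ≡⟨ 3*[2*n]≡2*[3*n] n ⟩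
  2 * (3 * n)       ≡⟨ cong (2 *_) 3n≡x+p ⟩
  2 * (x + 1 * p)   ≡⟨ 2*[x+1*p]≡2*x+2*p x p ⟩
  2 * x + 2 * p     ∎
  where
  3*[2*n]≡2*[3*n] : ∀ n → 3 * (2 * n) ≡ 2 * (3 * n)
  3*[2*n]≡2*[3*n] = ℕ-Solver.solve-∀
  2*[x+1*p]≡2*x+2*p : ∀ x p → 2 * (x + 1 * p) ≡ 2 * x + 2 * p
  2*[x+1*p]≡2*x+2*p = ℕ-Solver.solve-∀

3n≡x+p⇒2n≡y+p⇒2x≡3y+p : ∀ {n x y p} → 3 * n ≡ x + 1 * p → 2 * n ≡ y + 1 * p → 2 * x ≡ 3 * y + 1 * p
3n≡x+p⇒2n≡y+p⇒2x≡3y+p {n} {x} {y} {p} 3n≡x+p 2n≡y+p = +-cancelʳ-≡ (2 * p) _ _ (begin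
  2 * x + 2 * p       ≡⟨ 3n≡x+p⇒6n≡2x+2p {n} {x} {p} 3n≡x+p ⟨
  3 * (2 * n)         ≡⟨ cong (3 *_) 2n≡y+p ⟩
  3 * (y + 1 * p)     ≡⟨ 3*[y+1*p]≡3*y+1*p+2*p y p ⟩
  3 * y + 1 * p + 2 * p ∎)
  where
  3*[y+1*p]≡3*y+1*p+2*p : ∀ y p → 3 * (y + 1 * p) ≡ 3 * y + 1 * p + 2 * p
  3*[y+1*p]≡3*y+1*p+2*p = ℕ-Solver.solve-∀

module _ {p : ℕ} .{{_ : NonZero p}} {c : ℤ} (reflect : LiouvilleReflection p c) where

  -- x = p − k (p − n): reflect, multiply by the prime k, reflect back.
  liouville-reflect-* : ∀ {j n x} → Prime (suc j) → 0 < n → n < p → 0 < x →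
                        suc j * n ≡ x + j * p → liouville x ≡ -ℤ liouville n
  liouville-reflect-* {j} {n} {x} k-prime 0<n n<p 0<x kn≡x+jp = begin
    liouville x              ≡⟨ reflect 0<km 0<x km+x≡p ⟩
    c *ℤ liouville (k * m)   ≡⟨ cong (c *ℤ_) (liouville-*-prime k-prime 0<m) ⟩
    c *ℤ -ℤ liouville m      ≡⟨ ℤ.neg-distribʳ-* c (liouville m) ⟨
    -ℤ (c *ℤ liouville m)    ≡⟨ cong -ℤ_ (reflect 0<m 0<n m+n≡p) ⟨
    -ℤ liouville n           ∎
    where
    k = suc j
    m = p ∸ n
    0<m : 0 < m
    0<m = m<n⇒0<n∸m n<p
    0<km : 0 < k * m
    0<km = ≤-trans 0<m (m≤m+n m (j * m))
    m+n≡p : m + n ≡ p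
    m+n≡p = trans (+-comm m n) (m+[n∸m]≡n (<⇒≤ n<p))
    km+x≡p : k * m + x ≡ p
    km+x≡p = +-cancelʳ-≡ (j * p) _ _ (begin
      k * m + x + j * p     ≡⟨ +-assoc (k * m) x (j * p) ⟩
      k * m + (x + j * p)   ≡⟨ cong (_+_ (k * m)) kn≡x+jp ⟨
      k * m + k * n         ≡⟨ *-distribˡ-+ k m n ⟨
      k * (m + n)           ≡⟨ cong (k *_) m+n≡p ⟩
      k * p                 ∎)

  liouville-[2*n]%p : ∀ {n} → Prime p → 2 < p → 0 < n → n < p → liouville ((2 * n) % p) ≡ -ℤ liouville n
  liouville-[2*n]%p {n} p-prime 2<p 0<n n<p
    with (2 * n) / p | m≡m%n+[m/n]*n (2 * n) p | m<n*o⇒m/o<n {2 * n} {2} (*-monoʳ-< 2 n<p)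
  ... | 0           | 2n≡x   | _ = subst (λ x → liouville x ≡ -ℤ liouville n) (trans 2n≡x (+-identityʳ _))
                                    (liouville-*-prime prime[2] 0<n)
  ... | 1           | 2n≡x+p | _ =
    liouville-reflect-* prime[2] 0<n n<p ([a*n]%p>0 p-prime (s≤s z≤n) 2<p 0<n n<p) 2n≡x+p
  ... | suc (suc _) | _      | s≤s (s≤s ())

  -- Go through y = 2n mod p: if y = 2n then 3 · 2n = 2x + 2p, otherwise 2x = 3y + p.
  liouville-[3n∸p] : ∀ {n x} → Prime p → 2 < p → 0 < n → n < p → 0 < x → x < p →
                     3 * n ≡ x + 1 * p → liouville x ≡ -ℤ liouville n
  liouville-[3n∸p] {n} {x} p-prime 2<p 0<n n<p 0<x x<p 3n≡x+p
    with (2 * n) / p | m≡m%n+[m/n]*n (2 * n) p | m<n*o⇒m/o<n {2 * n} {2} (*-monoʳ-< 2 n<p)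
  ... | 0 | 2n≡y | _ = ℤ.neg-injective (begin
    -ℤ liouville x          ≡⟨ liouville-*-prime prime[2] 0<x ⟨
    liouville (2 * x)       ≡⟨ liouville-reflect-* prime[3] (*-monoʳ-< 2 0<n) 2n<p (*-monoʳ-< 2 0<x)
                                 (3n≡x+p⇒6n≡2x+2p {n} {x} {p} 3n≡x+p) ⟩
    -ℤ liouville (2 * n)    ≡⟨ cong -ℤ_ (liouville-*-prime prime[2] 0<n) ⟩
    -ℤ (-ℤ liouville n)     ∎)
    where
    2n<p : 2 * n < p
    2n<p = subst (_< p) (sym (trans 2n≡y (+-identityʳ _))) (m%n<n (2 * n) p)
  ... | 1 | 2n≡y+p | _ = ℤ.neg-injective (begin
    -ℤ liouville x          ≡⟨ liouville-reflect-* prime[2] 0<x x<p (*-monoʳ-< 3 0<y)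
                                 (3n≡x+p⇒2n≡y+p⇒2x≡3y+p {n} {x} {y} {p} 3n≡x+p 2n≡y+p) ⟨
    liouville (3 * y)       ≡⟨ liouville-*-prime prime[3] 0<y ⟩
    -ℤ liouville y          ≡⟨ cong -ℤ_ (liouville-[2*n]%p p-prime 2<p 0<n n<p) ⟩
    -ℤ (-ℤ liouville n)     ∎)
    where
    y = (2 * n) % p
    0<y : 0 < y
    0<y = [a*n]%p>0 p-prime (s≤s z≤n) 2<p 0<n n<p
  ... | suc (suc _) | _ | s≤s (s≤s ())

  liouville-[3*n]%p : ∀ {n} → Prime p → 3 < p → 0 < n → n < p → liouville ((3 * n) % p) ≡ -ℤ liouville n
  liouville-[3*n]%p {n} p-prime 3<p 0<n n<p
    with (3 * n) / p | m≡m%n+[m/n]*n (3 * n) p | m<n*o⇒m/o<n {3 * n} {3} (*-monoʳ-< 3 n<p)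
  ... | 0 | 3n≡x | _ = subst (λ x → liouville x ≡ -ℤ liouville n) (trans 3n≡x (+-identityʳ _))
                         (liouville-*-prime prime[3] 0<n)
  ... | 1 | 3n≡x+p | _ =
    liouville-[3n∸p] p-prime (<⇒≤ 3<p) 0<n n<p ([a*n]%p>0 p-prime (s≤s z≤n) 3<p 0<n n<p) (m%n<n (3 * n) p) 3n≡x+p
  ... | 2 | 3n≡x+2p | _ =
    liouville-reflect-* prime[3] 0<n n<p ([a*n]%p>0 p-prime (s≤s z≤n) 3<p 0<n n<p) 3n≡x+2p
  ... | suc (suc (suc _)) | _ | s≤s (s≤s (s≤s ()))

≗⇒≈ζ : ∀ {p} {a b : Cyc p} → a ≗ b → a ≈ζ b
≗⇒≈ζ a≗b = 0ℤ , λ r → trans (a≗b r) (sym (ℤ.+-identityʳ _))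

lemma2p3 : (p : ℕ) → .{{_ : NonZero p}} → Prime p → p > 3 → ∣ Lλ p ∣ ≡ p ∸ 1 →
    ((ξ : Fin p) → (Sλ p (3 * toℕ ξ) ≈ζ Sλ p (2 * toℕ ξ))
                 × (Sλ p (2 * toℕ ξ) ≈ζ negζ (Sλ p (toℕ ξ))))
    × ((j k : ℕ) → (Sλ p (3 ^ j) ≈ζ signζ j (Sλ p 1))
                 × (Sλ p (2 ^ k) ≈ζ signζ k (Sλ p 1)))
lemma2p3 p p-prime 3<p ∣Lλ∣≡p∸1 =
    (λ ξ → ≗⇒≈ζ (λ r → trans (S₃ (toℕ ξ) r) (sym (S₂ (toℕ ξ) r))) , ≗⇒≈ζ (S₂ (toℕ ξ)))
  , (λ j k → ≗⇒≈ζ (Sλ-^-signζ S₃ j) , ≗⇒≈ζ (Sλ-^-signζ S₂ k))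
  where
  c : ℤ
  c = proj₁ (∣Lλ∣≡p∸1⇒reflection p ∣Lλ∣≡p∸1)
  reflect : LiouvilleReflection p c
  reflect = proj₂ (∣Lλ∣≡p∸1⇒reflection p ∣Lλ∣≡p∸1)
  S₂ : ∀ ξ → Sλ p (2 * ξ) ≗ negζ (Sλ p ξ)
  S₂ = Sλ-*-negate 2 (mod-inverse p-prime (s≤s z≤n) (<⇒≤ 3<p))
                     (liouville-[2*n]%p {c = c} reflect p-prime (<⇒≤ 3<p))
  S₃ : ∀ ξ → Sλ p (3 * ξ) ≗ negζ (Sλ p ξ)
  S₃ = Sλ-*-negate 3 (mod-inverse p-prime (s≤s z≤n) 3<p)
                     (liouville-[3*n]%p {c = c} reflect p-prime 3<p)
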